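{- Let $n \geq 4$ and let $P_n$ be the path on $n$ vertices. Then $\chi_s(S(P_n)) = 4$.
   Context: All graphs are finite, simple and undirected. A star coloring of a graph $G$ is a proper vertex coloring of $G$ in which every path on four vertices uses at least three distinct colors. The star chromatic number $\chi_s(G)$ is the least number of colors in a star coloring of $G$. The splitting graph $S(G)$ of a graph $G$ is obtained from $G$ by adding, for each vertex $v$ of $G$, a new vertex $v'$ whose neighborhood is $N(v')=N(v)$, the neighborhood of $v$ in $G$ (the new vertices are pairwise nonadjacent). -}

module Defs where

open import Data.Nat using (ℕ; suc; _+_; _≤_; _<_)
open import Data.Fin using (Fin; toℕ)
open import Data.Fin.Properties using (_≟_)
open import Data.Sum using (_⊎_; inj₁; inj₂)
open import Data.Product using (_×_; Σ; ∃)
open import Data.List using (List; []; _∷_; length; deduplicate)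
open import Data.Empty using (⊥)
open import Relation.Nullary using (¬_)
open import Relation.Binary.PropositionalEquality using (_≡_; _≢_)

PathAdj : ∀ {n} → Fin n → Fin n → Set
PathAdj i j = (suc (toℕ i) ≡ toℕ j) ⊎ (suc (toℕ j) ≡ toℕ i)

-- Splitting graph: vertex set V ⊎ V' (inj₁ v = v, inj₂ v = v').
-- v ~ w in S(G) iff v ~ w in G;  v' ~ w iff v ~ w in G; v ~ w' iff v ~ w in G;
-- primed vertices pairwise nonadjacent.
SplitAdj : ∀ {V : Set} → (V → V → Set) → V ⊎ V → V ⊎ V → Set
SplitAdj A (inj₁ u) (inj₁ v) = A u v
SplitAdj A (inj₁ u) (inj₂ v) = A u v
SplitAdj A (inj₂ u) (inj₁ v) = A u v
SplitAdj A (inj₂ u) (inj₂ v) = ⊥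

Proper : ∀ {V : Set} (Adj : V → V → Set) {k : ℕ} → (V → Fin k) → Set
Proper {V} Adj c = ∀ (u v : V) → Adj u v → c u ≢ c v

numColors : ∀ {k} → List (Fin k) → ℕ
numColors xs = length (deduplicate _≟_ xs)

IsStarColoring : ∀ {V : Set} (Adj : V → V → Set) {k : ℕ} → (V → Fin k) → Set
IsStarColoring {V} Adj c =
  Proper Adj c ×
  (∀ (a b d e : V) →
     a ≢ b → a ≢ d → a ≢ e → b ≢ d → b ≢ e → d ≢ e →
     Adj a b → Adj b d → Adj d e →
     3 ≤ numColors (c a ∷ c b ∷ c d ∷ c e ∷ []))

StarColorable : ∀ {V : Set} (Adj : V → V → Set) → ℕ → Set
StarColorable {V} Adj k = Σ (V → Fin k) (IsStarColoring Adj)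

StarChromaticNumberIs : ∀ {V : Set} (Adj : V → V → Set) → ℕ → Set
StarChromaticNumberIs Adj m =
  StarColorable Adj m × (∀ k → k < m → ¬ StarColorable Adj k)

SPathAdj : (n : ℕ) → (Fin n ⊎ Fin n) → (Fin n ⊎ Fin n) → Set
SPathAdj n = SplitAdj (PathAdj {n})

module Submission where

-- Upper bound: colour v_i by i mod 3 and every v_i' by a fourth colour.
-- Two distinct vertices of S(P_n) at distance at most two that share a
-- colour must both be primed; since primed vertices are independent,
-- a bicoloured P4 cannot exist.
--
-- Lower bound: with at most three colours, a "twin" w of v_1 (adjacent
-- to v_0 and v_2) on a path v_0 v_1 v_2 v_3 is forced to get the colour
-- of v_1 (twinColour, a pigeonhole argument).  Applied to v_1' and, by
-- reflection, to v_2', it makes v_1' v_2 v_1 v_2' a bicoloured P4.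

open import Defs
open import Data.Nat using (ℕ; suc; _≤_; _<_; _+_; s≤s; z≤n)
open import Data.Fin using (Fin; toℕ; inject₁; fromℕ) renaming (zero to 0F; suc to sucF)
open import Data.Fin.Properties using (_≟_; toℕ-injective; inject₁-injective; fromℕ≢inject₁; pigeonhole)
open import Data.Nat.Properties using (suc-injective; ≤⇒≯)
open import Data.List using (List; []; _∷_; length)
open import Data.List.Membership.Propositional using (_∈_)
open import Data.List.Membership.Propositional.Properties using (∈-deduplicate⁺; ∈-deduplicate⁻)
open import Data.List.Relation.Unary.Any using (here; there)
open import Data.List.Relation.Unary.All using (_∷_)
open import Data.List.Relation.Unary.AllPairs using (_∷_)
open import Data.List.Relation.Unary.Unique.Propositional using (Unique)
open import Data.List.Relation.Unary.Unique.DecPropositional.Properties using (deduplicate-!)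
open import Data.Sum using (_⊎_; inj₁; inj₂)
open import Data.Product using (_×_; _,_)
open import Data.Unit using (⊤; tt)
open import Data.Empty using (⊥; ⊥-elim)
open import Relation.Nullary using (¬_; yes; no)
open import Relation.Binary.PropositionalEquality using (_≡_; _≢_; refl; sym; trans; cong; ≢-sym)

distinctMembers⇒3≤length : ∀ {A : Set} {a b c : A} (xs : List A) →
  a ≢ b → a ≢ c → b ≢ c → a ∈ xs → b ∈ xs → c ∈ xs → 3 ≤ length xs
distinctMembers⇒3≤length (_ ∷ _ ∷ _ ∷ _) _ _ _ _ _ _ = s≤s (s≤s (s≤s z≤n))
distinctMembers⇒3≤length (_ ∷ []) a≢b _ _ (here refl) (here refl) _ = ⊥-elim (a≢b refl)
distinctMembers⇒3≤length (_ ∷ _ ∷ []) a≢b a≢c b≢c a∈ b∈ c∈ with a∈ | b∈ | c∈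
... | here refl         | here refl         | _                 = ⊥-elim (a≢b refl)
... | there (here refl) | there (here refl) | _                 = ⊥-elim (a≢b refl)
... | here refl         | _                 | here refl         = ⊥-elim (a≢c refl)
... | there (here refl) | _                 | there (here refl) = ⊥-elim (a≢c refl)
... | _                 | here refl         | here refl         = ⊥-elim (b≢c refl)
... | _                 | there (here refl) | there (here refl) = ⊥-elim (b≢c refl)

uniqueInPair⇒length≤2 : ∀ {A : Set} {x y : A} (ds : List A) → Unique ds →
  (∀ {z} → z ∈ ds → z ∈ x ∷ y ∷ []) → length ds ≤ 2
uniqueInPair⇒length≤2 [] _ _ = z≤n
uniqueInPair⇒length≤2 (_ ∷ []) _ _ = s≤s z≤n
uniqueInPair⇒length≤2 (_ ∷ _ ∷ []) _ _ = s≤s (s≤s z≤n)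
uniqueInPair⇒length≤2 (p ∷ q ∷ r ∷ _) ((p≢q ∷ p≢r ∷ _) ∷ (q≢r ∷ _) ∷ _) inPair
  with distinctMembers⇒3≤length _ p≢q p≢r q≢r
         (inPair (here refl)) (inPair (there (here refl))) (inPair (there (there (here refl))))
... | s≤s (s≤s ())

distinct⇒3≤numColors : ∀ {k} {a b c : Fin k} (xs : List (Fin k)) →
  a ≢ b → a ≢ c → b ≢ c → a ∈ xs → b ∈ xs → c ∈ xs → 3 ≤ numColors xs
distinct⇒3≤numColors _ a≢b a≢c b≢c a∈ b∈ c∈ =
  distinctMembers⇒3≤length _ a≢b a≢c b≢c
    (∈-deduplicate⁺ _≟_ a∈) (∈-deduplicate⁺ _≟_ b∈) (∈-deduplicate⁺ _≟_ c∈)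

numColors-alternating≤2 : ∀ {k} (x y : Fin k) → numColors (x ∷ y ∷ x ∷ y ∷ []) ≤ 2
numColors-alternating≤2 x y =
  uniqueInPair⇒length≤2 _ (deduplicate-! _≟_ xyxy) (λ z∈ → inPair (∈-deduplicate⁻ _≟_ xyxy z∈))
  where
  xyxy : List _
  xyxy = x ∷ y ∷ x ∷ y ∷ []
  inPair : ∀ {z} → z ∈ xyxy → z ∈ x ∷ y ∷ []
  inPair (here refl) = here refl
  inPair (there (here refl)) = there (here refl)
  inPair (there (there (here refl))) = here refl
  inPair (there (there (there (here refl)))) = there (here refl)

Bicoloured : ∀ {k} → Fin k → Fin k → Fin k → Fin k → Set
Bicoloured x y z w = x ≡ z × y ≡ w

nonAlternating⇒3≤numColors : ∀ {k} (x y z w : Fin k) →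
  x ≢ y → y ≢ z → z ≢ w → ¬ Bicoloured x y z w →
  3 ≤ numColors (x ∷ y ∷ z ∷ w ∷ [])
nonAlternating⇒3≤numColors x y z w x≢y y≢z z≢w notBi with x ≟ z
... | no x≢z = distinct⇒3≤numColors (x ∷ y ∷ z ∷ w ∷ []) x≢y x≢z y≢z
                 (here refl) (there (here refl)) (there (there (here refl)))
... | yes refl = distinct⇒3≤numColors (x ∷ y ∷ x ∷ w ∷ []) x≢y z≢w (λ y≡w → notBi (refl , y≡w))
                 (here refl) (there (here refl)) (there (there (there (here refl))))

star⇒noBicolouredP4 : ∀ {V : Set} {Adj : V → V → Set} {k} {c : V → Fin k} →
  IsStarColoring Adj c → ∀ a b d e →
  a ≢ b → a ≢ d → a ≢ e → b ≢ d → b ≢ e → d ≢ e →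
  Adj a b → Adj b d → Adj d e → ¬ Bicoloured (c a) (c b) (c d) (c e)
star⇒noBicolouredP4 {c = c} (_ , star) a b d e a≢b a≢d a≢e b≢d b≢e d≢e ab bd de (ca≡cd , cb≡ce) =
  ≤⇒≯ atMostTwo (star a b d e a≢b a≢d a≢e b≢d b≢e d≢e ab bd de)
  where
  atMostTwo : numColors (c a ∷ c b ∷ c d ∷ c e ∷ []) ≤ 2
  atMostTwo rewrite sym ca≡cd | sym cb≡ce = numColors-alternating≤2 (c a) (c b)

noBicolouredP4⇒star : ∀ {V : Set} {Adj : V → V → Set} {k} {c : V → Fin k} →
  Proper Adj c →
  (∀ a b d e → a ≢ d → b ≢ e → Adj a b → Adj b d → Adj d e →
     ¬ Bicoloured (c a) (c b) (c d) (c e)) →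
  IsStarColoring Adj c
noBicolouredP4⇒star {c = c} proper noBi = proper , λ a b d e _ a≢d _ _ b≢e _ ab bd de →
  nonAlternating⇒3≤numColors (c a) (c b) (c d) (c e)
    (proper a b ab) (proper b d bd) (proper d e de) (noBi a b d e a≢d b≢e ab bd de)

base : ∀ {V : Set} → V ⊎ V → V
base (inj₁ v) = v
base (inj₂ v) = v

splitAdj⇒adj : ∀ {V : Set} {A : V → V → Set} (u v : V ⊎ V) →
  SplitAdj A u v → A (base u) (base v)
splitAdj⇒adj (inj₁ _) (inj₁ _) a = a
splitAdj⇒adj (inj₁ _) (inj₂ _) a = a
splitAdj⇒adj (inj₂ _) (inj₁ _) a = a

Primed : ∀ {V : Set} → V ⊎ V → Set
Primed (inj₁ _) = ⊥
Primed (inj₂ _) = ⊤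

primedIndependent : ∀ {V : Set} {A : V → V → Set} (u v : V ⊎ V) →
  SplitAdj A u v → Primed u → Primed v → ⊥
primedIndependent (inj₂ _) (inj₂ _) ()

rotate : Fin 3 → Fin 3
rotate 0F = sucF 0F
rotate (sucF 0F) = sucF (sucF 0F)
rotate (sucF (sucF 0F)) = 0F

mod3 : ℕ → Fin 3
mod3 0 = 0F
mod3 (suc t) = rotate (mod3 t)

rotate≢ : ∀ x → rotate x ≢ x
rotate≢ 0F ()
rotate≢ (sucF 0F) ()
rotate≢ (sucF (sucF 0F)) ()

rotate²≢ : ∀ x → rotate (rotate x) ≢ x
rotate²≢ 0F ()
rotate²≢ (sucF 0F) ()
rotate²≢ (sucF (sucF 0F)) ()

mod3-adjacent : ∀ {n} {u v : Fin n} → PathAdj u v → mod3 (toℕ u) ≢ mod3 (toℕ v)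
mod3-adjacent (inj₁ u→v) rewrite sym u→v = λ eq → rotate≢ _ (sym eq)
mod3-adjacent (inj₂ v→u) rewrite sym v→u = rotate≢ _

mod3-distanceTwo : ∀ {n} {u v w : Fin n} → PathAdj u v → PathAdj v w → u ≢ w →
  mod3 (toℕ u) ≢ mod3 (toℕ w)
mod3-distanceTwo (inj₁ u→v) (inj₁ v→w) _ rewrite sym v→w | sym u→v = λ eq → rotate²≢ _ (sym eq)
mod3-distanceTwo (inj₂ v→u) (inj₂ w→v) _ rewrite sym v→u | sym w→v = rotate²≢ _
mod3-distanceTwo (inj₁ u→v) (inj₂ w→v) u≢w _ =
  u≢w (toℕ-injective (suc-injective (trans u→v (sym w→v))))
mod3-distanceTwo (inj₂ v→u) (inj₁ v→w) u≢w _ = u≢w (toℕ-injective (trans (sym v→u) v→w))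

splitColouring : ∀ {n} → Fin n ⊎ Fin n → Fin 4
splitColouring (inj₁ i) = inject₁ (mod3 (toℕ i))
splitColouring (inj₂ _) = fromℕ 3

splitColouring-proper : ∀ n → Proper (SPathAdj n) splitColouring
splitColouring-proper n (inj₁ _) (inj₁ _) adj eq = mod3-adjacent adj (inject₁-injective eq)
splitColouring-proper n (inj₁ _) (inj₂ _) _ eq = fromℕ≢inject₁ (sym eq)
splitColouring-proper n (inj₂ _) (inj₁ _) _ eq = fromℕ≢inject₁ eq

sameColourNear⇒primed : ∀ {n} (u v w : Fin n ⊎ Fin n) →
  SPathAdj n u v → SPathAdj n v w → u ≢ w →
  splitColouring u ≡ splitColouring w → Primed u × Primed w
sameColourNear⇒primed (inj₁ i) v (inj₁ j) uv vw u≢w eq =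
  ⊥-elim (mod3-distanceTwo (splitAdj⇒adj (inj₁ i) v uv) (splitAdj⇒adj v (inj₁ j) vw)
            (λ i≡j → u≢w (cong inj₁ i≡j)) (inject₁-injective eq))
sameColourNear⇒primed (inj₁ _) _ (inj₂ _) _ _ _ eq = ⊥-elim (fromℕ≢inject₁ (sym eq))
sameColourNear⇒primed (inj₂ _) _ (inj₁ _) _ _ _ eq = ⊥-elim (fromℕ≢inject₁ eq)
sameColourNear⇒primed (inj₂ _) _ (inj₂ _) _ _ _ _ = tt , tt

-- If a-b-d-e were bicoloured, a and d would be primed, hence b and e
-- unprimed, yet b and e would also have to be primed.
splitColouring-star : ∀ n → IsStarColoring (SPathAdj n) splitColouring
splitColouring-star n = noBicolouredP4⇒star (splitColouring-proper n) noBicoloured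
  where
  noBicoloured : ∀ a b d e → a ≢ d → b ≢ e →
    SPathAdj n a b → SPathAdj n b d → SPathAdj n d e →
    ¬ Bicoloured (splitColouring a) (splitColouring b) (splitColouring d) (splitColouring e)
  noBicoloured a b d e a≢d b≢e ab bd de (ca≡cd , cb≡ce)
    with sameColourNear⇒primed a b d ab bd a≢d ca≡cd
  ... | _ , d′ with sameColourNear⇒primed b d e bd de b≢e cb≡ce
  ...   | b′ , _ = primedIndependent b d bd b′ d′

thirdColour : ∀ {k} → k < 4 → {a b p q : Fin k} →
  a ≢ b → p ≢ a → p ≢ b → q ≢ a → q ≢ b → p ≡ q
thirdColour k<4 {a} {b} {p} {q} a≢b p≢a p≢b q≢a q≢b with pigeonhole k<4 colour
  where
  colour : Fin 4 → Fin _
  colour 0F = a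
  colour (sucF 0F) = b
  colour (sucF (sucF 0F)) = p
  colour (sucF (sucF (sucF 0F))) = q
... | 0F , sucF 0F , _ , eq = ⊥-elim (a≢b eq)
... | 0F , sucF (sucF 0F) , _ , eq = ⊥-elim (p≢a (sym eq))
... | 0F , sucF (sucF (sucF 0F)) , _ , eq = ⊥-elim (q≢a (sym eq))
... | sucF 0F , sucF (sucF 0F) , _ , eq = ⊥-elim (p≢b (sym eq))
... | sucF 0F , sucF (sucF (sucF 0F)) , _ , eq = ⊥-elim (q≢b (sym eq))
... | sucF (sucF 0F) , sucF (sucF (sucF 0F)) , _ , eq = eq
... | 0F , 0F , () , _
... | sucF _ , 0F , () , _
... | sucF 0F , sucF 0F , s≤s () , _
... | sucF (sucF _) , sucF 0F , s≤s () , _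
... | sucF (sucF 0F) , sucF (sucF 0F) , s≤s (s≤s ()) , _
... | sucF (sucF (sucF 0F)) , sucF (sucF 0F) , s≤s (s≤s ()) , _
... | sucF (sucF (sucF 0F)) , sucF (sucF (sucF 0F)) , s≤s (s≤s (s≤s ())) , _

-- In a star colouring with at most three colours, let v_0 v_1 v_2 v_3 be a
-- path and w a common neighbour of v_0 and v_2 (colours p_i and q).  Then
-- w gets the colour of v_1: otherwise v_0 and then v_3 are forced onto the
-- remaining colours, making v_0 w v_2 v_3 or v_0 v_1 v_2 v_3 bicoloured.
twinColour : ∀ {k} → k < 4 → {p₀ p₁ p₂ p₃ q : Fin k} →
  p₀ ≢ p₁ → p₁ ≢ p₂ → p₂ ≢ p₃ → q ≢ p₀ → q ≢ p₂ →
  ¬ Bicoloured p₀ p₁ p₂ p₃ → ¬ Bicoloured p₀ q p₂ p₃ → q ≡ p₁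
twinColour k<4 {p₀} {p₁} {p₂} {p₃} {q} p₀≢p₁ p₁≢p₂ p₂≢p₃ q≢p₀ q≢p₂ path twinPath with q ≟ p₁
... | yes q≡p₁ = q≡p₁
... | no q≢p₁ = ⊥-elim (path (p₀≡p₂ , sym p₃≡p₁))
  where
  p₀≡p₂ : p₀ ≡ p₂
  p₀≡p₂ = thirdColour k<4 (≢-sym q≢p₁) p₀≢p₁ (≢-sym q≢p₀) (≢-sym p₁≢p₂) (≢-sym q≢p₂)
  q≢p₃ : q ≢ p₃
  q≢p₃ q≡p₃ = twinPath (p₀≡p₂ , q≡p₃)
  p₃≡p₁ : p₃ ≡ p₁
  p₃≡p₁ = thirdColour k<4 (≢-sym q≢p₂) (≢-sym p₂≢p₃) (≢-sym q≢p₃) p₁≢p₂ (≢-sym q≢p₁)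

-- The twin argument applied to v_1' and (reading the path backwards) to
-- v_2' forces c v_1' ≡ c v_1 and c v_2' ≡ c v_2, so that the path
-- v_1' v_2 v_1 v_2' is bicoloured.
noStarColouringBelow4 : ∀ m {k} → k < 4 → ¬ StarColorable (SPathAdj (4 + m)) k
noStarColouringBelow4 m k<4 (c , star@(proper , _)) =
  noBicoloured v₁′ v₂ v₁ v₂′ (λ ()) (λ ()) (λ ()) (λ ()) (λ ()) (λ ())
    (inj₁ refl) (inj₂ refl) (inj₁ refl) (twin₁ , sym twin₂)
  where
  v₀ v₁ v₂ v₃ v₁′ v₂′ : Fin (4 + m) ⊎ Fin (4 + m)
  v₀ = inj₁ 0F
  v₁ = inj₁ (sucF 0F)
  v₂ = inj₁ (sucF (sucF 0F))
  v₃ = inj₁ (sucF (sucF (sucF 0F)))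
  v₁′ = inj₂ (sucF 0F)
  v₂′ = inj₂ (sucF (sucF 0F))

  noBicoloured : ∀ a b d e → a ≢ b → a ≢ d → a ≢ e → b ≢ d → b ≢ e → d ≢ e →
    SPathAdj (4 + m) a b → SPathAdj (4 + m) b d → SPathAdj (4 + m) d e →
    ¬ Bicoloured (c a) (c b) (c d) (c e)
  noBicoloured = star⇒noBicolouredP4 star

  twin₁ : c v₁′ ≡ c v₁
  twin₁ = twinColour k<4
    (proper v₀ v₁ (inj₁ refl)) (proper v₁ v₂ (inj₁ refl)) (proper v₂ v₃ (inj₁ refl))
    (proper v₁′ v₀ (inj₂ refl)) (proper v₁′ v₂ (inj₁ refl))
    (noBicoloured v₀ v₁ v₂ v₃ (λ ()) (λ ()) (λ ()) (λ ()) (λ ()) (λ ())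
       (inj₁ refl) (inj₁ refl) (inj₁ refl))
    (noBicoloured v₀ v₁′ v₂ v₃ (λ ()) (λ ()) (λ ()) (λ ()) (λ ()) (λ ())
       (inj₁ refl) (inj₁ refl) (inj₁ refl))

  twin₂ : c v₂′ ≡ c v₂
  twin₂ = twinColour k<4
    (proper v₃ v₂ (inj₂ refl)) (proper v₂ v₁ (inj₂ refl)) (proper v₁ v₀ (inj₂ refl))
    (proper v₂′ v₃ (inj₁ refl)) (proper v₂′ v₁ (inj₂ refl))
    (noBicoloured v₃ v₂ v₁ v₀ (λ ()) (λ ()) (λ ()) (λ ()) (λ ()) (λ ())
       (inj₂ refl) (inj₂ refl) (inj₂ refl))
    (noBicoloured v₃ v₂′ v₁ v₀ (λ ()) (λ ()) (λ ()) (λ ()) (λ ()) (λ ())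
       (inj₂ refl) (inj₂ refl) (inj₂ refl))

theorem3 : (n : ℕ) → 4 ≤ n → StarChromaticNumberIs (SPathAdj n) 4
theorem3 _ (s≤s (s≤s (s≤s (s≤s {n = m} _)))) =
  (splitColouring , splitColouring-star (4 + m)) ,
  λ k k<4 → noStarColouringBelow4 m k<4
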